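{- Let $p>3$ be a prime and $i=\sqrt{ -1}$. Then $$\sum_{k=0}^{\frac{p-1}{2}}\frac{(\frac12)_k^2\,(\frac12+\frac{p}{2})_k\,(\frac12-\frac{p}{2})_k}{k!^2\,(1-i\frac{p}{2})_k\,(1+i\frac{p}{2})_k}\equiv\sum_{k=0}^{\frac{p-1}{2}}\left(\frac{(\frac12)_k}{k!}\right)^4\pmod{p^3}.$$
   Context: For $a\in\mathbb{C}$ and $k\in\mathbb{N}$, $(a)_k=a(a+1)\cdots(a+k-1)$ denotes the rising factorial, with $(a)_0=1$. Note $(1-i\frac p2)_k(1+i\frac p2)_k=\prod_{j=1}^{k}(j^2+\frac{p^2}{4})$ is rational, so both sides are rational numbers. A congruence $A\equiv B \pmod{p^m}$ between rational numbers means that $A-B\in p^m\mathbb{Z}_{(p)}$. -}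

module Defs where

open import Data.Nat as ℕ using (ℕ; zero; suc)
open import Data.Nat.Divisibility as ℕD using ()
open import Data.Integer as ℤ using (ℤ)
open import Data.Rational as ℚ using (ℚ; 0ℚ; 1ℚ; ½; _+_; _-_; _*_; _÷_; ↥_; ↧ₙ_)
open import Data.Rational.Properties using (_≟_)
open import Relation.Nullary using (¬_; yes; no)

nq : ℕ → ℚ
nq n = ℚ._/_ (ℤ.+ n) 1

poch : ℚ → ℕ → ℚ
poch a zero    = 1ℚ
poch a (suc k) = poch a k * (a + nq k)

fact : ℕ → ℚ
fact k = poch 1ℚ k

-- total division; only ever applied to nonzero denominators below
_÷?_ : ℚ → ℚ → ℚ
a ÷? b with b ≟ 0ℚ
... | yes _  = 0ℚ
... | no b≢0 = _÷_ a b {{ℚ.≢-nonZero b≢0}}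

-- (1 - i p/2)_k (1 + i p/2)_k = ∏_{j=1}^k (j^2 + p^2/4)  (rational)
conjPoch : ℕ → ℕ → ℚ
conjPoch p zero    = 1ℚ
conjPoch p (suc k) = conjPoch p k * (nq (suc k) * nq (suc k) + (nq p * nq p) ÷? nq 4)

sumTo : ℕ → (ℕ → ℚ) → ℚ
sumTo zero    f = f 0
sumTo (suc n) f = sumTo n f + f (suc n)

-- A ≡ B (mod p^m) for rationals: A - B ∈ p^m ℤ_(p)
-- (on the reduced fraction: p^m divides the numerator, p does not divide the denominator)
_≡_[modℚ_^_] : ℚ → ℚ → ℕ → ℕ → Set
A ≡ B [modℚ p ^ m ] =
  (p ℕ.^ m) ℕD.∣ ℤ.∣ ↥ (A - B) ∣ × ¬ (p ℕD.∣ (↧ₙ (A - B)))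
  where open import Data.Product using (_×_)

lhsTerm : ℕ → ℕ → ℚ
lhsTerm p k =
  (poch ½ k * poch ½ k * poch (½ + nq p ÷? nq 2) k * poch (½ - nq p ÷? nq 2) k)
  ÷? (fact k * fact k * conjPoch p k)

rhsTerm : ℕ → ℚ
rhsTerm k = let r = poch ½ k ÷? fact k in r * r * r * r

-- Write p = 2n + 1, h = p/2 and ε = h² = p²/4, and let ρ_k = (½)_k / k!.  Then
-- (½+h)_k (½-h)_k = ∏_{j<k} ((½+j)² - ε) and (1-ih)_k (1+ih)_k = ∏_{j<k} ((j+1)² + ε),
-- and expanding both products to first order in ε shows that, modulo p⁴, the k-th term
-- on the left is ρ_k⁴ (1 - ε (H₂½(k) + H₂(k))), where H₂½(k) = Σ_{j<k} (½+j)⁻² and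
-- H₂(k) = Σ_{j<k} (j+1)⁻².  As p² ∣ ε, it remains to show p ∣ W = Σ_k ρ_k⁴ (H₂½(k) + H₂(k)).
-- Modulo p we have ½ + j ≡ -(n - j), hence ρ_k² ≡ C(n,k)² and H₂½(k) ≡ H₂(n) - H₂(n-k);
-- the symmetry C(n,k) = C(n,n-k) then gives W ≡ H₂(n) Σ_k C(n,k)⁴.  Finally
-- H₂(n) ≡ 0 (mod p) for p > 3: the sum Σ_{j=1}^{p-1} j⁻² is ≡ 2 H₂(n) by pairing j with
-- p - j, and ≡ H₂(n)/2 by splitting it into even and odd j.

module Submission where

open import Data.Empty using (⊥-elim)
open import Data.Integer as ℤ using (ℤ)
import Data.Integer.Divisibility.Signed as ℤ∣
import Data.Integer.Properties as ℤ
open import Data.Nat as ℕ using (ℕ; zero; suc; _∸_; _/_; _<_; _≤_; z≤n; s≤s; _!)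
open import Data.Nat.Combinatorics using (_C_; nCk≡n!/k![n-k]!; nCk≡nC[n∸k]; k![n∸k]!∣n!)
import Data.Nat.Coprimality as Coprimality
open import Data.Nat.DivMod using (_%_; m/n*n≡m; m%n<n; m≡m%n+[m/n]*n)
import Data.Nat.Divisibility as ℕ∣
open import Data.Nat.Divisibility.Core using (hasNonTrivialDivisor)
open import Data.Nat.Primality using (Prime; euclidsLemma; prime⇒nonZero; prime⇒nonTrivial)
import Data.Nat.Properties as ℕ
open import Data.Nat.Tactic.RingSolver using (solve-∀)
open import Data.Product using (_,_)
open import Data.Rational as ℚ using (ℚ; 0ℚ; 1ℚ; ½; _+_; _-_; _*_; -_; ↥_; ↧_; ↧ₙ_)
open import Data.Rational.Properties
import Data.Rational.Solver as ℚ-Solver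
import Data.Rational.Unnormalised as ℚᵘ
import Data.Rational.Unnormalised.Properties as ℚᵘ
open import Data.Sum using (inj₁; inj₂)
open import Level using (0ℓ)
open import Relation.Binary.Bundles using (Setoid)
open import Relation.Binary.PropositionalEquality
import Relation.Binary.Reasoning.Setoid as SetoidReasoning
open import Relation.Nullary using (¬_; yes; no)

open import Defs

open ℚ-Solver.+-*-Solver using (solve; _:+_; _:*_; :-_; _:-_; _:=_; con)

fromℤ : ℤ → ℚ
fromℤ a = ℚ._/_ a 1

private
  toℚᵘ-fromℤ : ∀ a → ℚ.toℚᵘ (fromℤ a) ℚᵘ.≃ ℚᵘ.mkℚᵘ a 0
  toℚᵘ-fromℤ a = toℚᵘ-fromℚᵘ (ℚᵘ.mkℚᵘ a 0)

fromℤ-+ : ∀ a b → fromℤ (a ℤ.+ b) ≡ fromℤ a + fromℤ b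
fromℤ-+ a b = toℚᵘ-injective (ℚᵘ.≃-trans (toℚᵘ-fromℤ (a ℤ.+ b)) (ℚᵘ.≃-sym (ℚᵘ.≃-trans (toℚᵘ-homo-+ (fromℤ a) (fromℤ b))
  (ℚᵘ.≃-trans (ℚᵘ.+-cong (toℚᵘ-fromℤ a) (toℚᵘ-fromℤ b))
    (ℚᵘ.*≡* (cong (ℤ._* ℤ.1ℤ) (cong₂ ℤ._+_ (ℤ.*-identityʳ a) (ℤ.*-identityʳ b))))))))

fromℤ-* : ∀ a b → fromℤ (a ℤ.* b) ≡ fromℤ a * fromℤ b
fromℤ-* a b = toℚᵘ-injective (ℚᵘ.≃-trans (toℚᵘ-fromℤ (a ℤ.* b)) (ℚᵘ.≃-sym (ℚᵘ.≃-trans (toℚᵘ-homo-* (fromℤ a) (fromℤ b))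
  (ℚᵘ.*-cong (toℚᵘ-fromℤ a) (toℚᵘ-fromℤ b)))))

fromℤ-neg : ∀ a → fromℤ (ℤ.- a) ≡ - fromℤ a
fromℤ-neg a = toℚᵘ-injective (ℚᵘ.≃-trans (toℚᵘ-fromℤ (ℤ.- a)) (ℚᵘ.≃-sym (ℚᵘ.≃-trans (toℚᵘ-homo‿- (fromℤ a))
  (ℚᵘ.-‿cong (toℚᵘ-fromℤ a)))))

fromℤ≡0⇒≡0 : ∀ a → fromℤ a ≡ 0ℚ → a ≡ ℤ.0ℤ
fromℤ≡0⇒≡0 a eq with ℚᵘ.≃-trans (ℚᵘ.≃-sym (toℚᵘ-fromℤ a)) (ℚᵘ.≃-trans (toℚᵘ-cong eq) (toℚᵘ-fromℤ ℤ.0ℤ))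
... | ℚᵘ.*≡* e = trans (sym (ℤ.*-identityʳ a)) e

fromℤ-injective : ∀ a b → fromℤ a ≡ fromℤ b → a ≡ b
fromℤ-injective a b e = ℤ.i-j≡0⇒i≡j a b (fromℤ≡0⇒≡0 (a ℤ.- b) (begin
  fromℤ (a ℤ.- b)         ≡⟨ fromℤ-+ a (ℤ.- b) ⟩
  fromℤ a + fromℤ (ℤ.- b) ≡⟨ cong₂ _+_ e (fromℤ-neg b) ⟩
  fromℤ b - fromℤ b       ≡⟨ +-inverseʳ (fromℤ b) ⟩
  0ℚ                      ∎))
  where open ≡-Reasoning

nq-+ : ∀ m k → nq (m ℕ.+ k) ≡ nq m + nq k
nq-+ m k = trans (cong fromℤ (ℤ.pos-+ m k)) (fromℤ-+ (ℤ.+ m) (ℤ.+ k))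

nq-* : ∀ m k → nq (m ℕ.* k) ≡ nq m * nq k
nq-* m k = trans (cong fromℤ (ℤ.pos-* m k)) (fromℤ-* (ℤ.+ m) (ℤ.+ k))

x*↧x≡↥x : ∀ x → x * fromℤ (↧ x) ≡ fromℤ (↥ x)
x*↧x≡↥x x@(ℚ.mkℚ n d-1 _) = toℚᵘ-injective (ℚᵘ.≃-trans (toℚᵘ-homo-* x (fromℤ (↧ x)))
  (ℚᵘ.≃-trans (ℚᵘ.*-congˡ {ℚᵘ.mkℚᵘ n d-1} (toℚᵘ-fromℤ (↧ x))) (ℚᵘ.≃-sym (ℚᵘ.≃-trans (toℚᵘ-fromℤ n) (ℚᵘ.*≡* eq)))))
  where
  eq : n ℤ.* ℤ.+ suc (d-1 ℕ.* 1) ≡ (n ℤ.* ℤ.+ suc d-1) ℤ.* ℤ.1ℤ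
  eq = trans (cong (λ z → n ℤ.* ℤ.+ suc z) (ℕ.*-identityʳ d-1)) (sym (ℤ.*-identityʳ _))

↧-coprime-↥ : ∀ x → Coprimality.Coprime (↧ₙ x) ℤ.∣ ↥ x ∣
↧-coprime-↥ (ℚ.mkℚ _ _ c) = Coprimality.sym (Coprimality.recompute c)

x÷?y*y≡x : ∀ x y → y ≢ 0ℚ → (x ÷? y) * y ≡ x
x÷?y*y≡x x y y≢0 with y ≟ 0ℚ
... | yes y≡0 = ⊥-elim (y≢0 y≡0)
... | no  y≢0 = trans (*-assoc x (ℚ.1/_ y {{ℚ.≢-nonZero y≢0}}) y)
  (trans (cong (x *_) (*-inverseˡ y {{ℚ.≢-nonZero y≢0}})) (*-identityʳ x))

_⁻¹ : ℚ → ℚ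
x ⁻¹ = 1ℚ ÷? x

x⁻¹*x≡1 : ∀ x → x ≢ 0ℚ → x ⁻¹ * x ≡ 1ℚ
x⁻¹*x≡1 = x÷?y*y≡x 1ℚ

*-cancelʳ-≡ : ∀ a b c → c ≢ 0ℚ → a * c ≡ b * c → a ≡ b
*-cancelʳ-≡ a b c c≢0 e = begin
  a                 ≡⟨ sym (*-identityʳ a) ⟩
  a * 1ℚ            ≡⟨ cong (a *_) (sym (x⁻¹*x≡1 c c≢0)) ⟩
  a * (c ⁻¹ * c)    ≡⟨ solve 3 (λ a i c → a :* (i :* c) := (a :* c) :* i) refl a (c ⁻¹) c ⟩
  (a * c) * c ⁻¹    ≡⟨ cong (_* c ⁻¹) e ⟩
  (b * c) * c ⁻¹    ≡⟨ solve 3 (λ b i c → (b :* c) :* i := b :* (i :* c)) refl b (c ⁻¹) c ⟩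
  b * (c ⁻¹ * c)    ≡⟨ cong (b *_) (x⁻¹*x≡1 c c≢0) ⟩
  b * 1ℚ            ≡⟨ *-identityʳ b ⟩
  b                 ∎
  where open ≡-Reasoning

q*y≡x⇒q≡x÷?y : ∀ x y q → y ≢ 0ℚ → q * y ≡ x → q ≡ x ÷? y
q*y≡x⇒q≡x÷?y x y q y≢0 e = *-cancelʳ-≡ q (x ÷? y) y y≢0 (trans e (sym (x÷?y*y≡x x y y≢0)))

infix 8 Σ< Π<

Σ< : ℕ → (ℕ → ℚ) → ℚ
Σ< zero    f = 0ℚ
Σ< (suc n) f = f 0 + Σ< n (λ k → f (suc k))

syntax Σ< n (λ k → e) = Σ[ k < n ] e

Π< : ℕ → (ℕ → ℚ) → ℚ
Π< zero    f = 1ℚ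
Π< (suc n) f = Π< n f * f n

syntax Π< n (λ k → e) = Π[ k < n ] e

Σ<-snoc : ∀ n f → Σ< (suc n) f ≡ Σ< n f + f n
Σ<-snoc zero    f = trans (+-identityʳ (f 0)) (sym (+-identityˡ (f 0)))
Σ<-snoc (suc n) f = trans (cong (f 0 +_) (Σ<-snoc n (λ k → f (suc k)))) (sym (+-assoc (f 0) _ _))

sumTo≡Σ< : ∀ n f → sumTo n f ≡ Σ< (suc n) f
sumTo≡Σ< zero    f = sym (+-identityʳ (f 0))
sumTo≡Σ< (suc n) f = trans (cong (_+ f (suc n)) (sumTo≡Σ< n f)) (sym (Σ<-snoc (suc n) f))

Σ<-cong : ∀ n {f g} → (∀ k → k < n → f k ≡ g k) → Σ< n f ≡ Σ< n g
Σ<-cong zero    f≡g = refl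
Σ<-cong (suc n) f≡g = cong₂ _+_ (f≡g 0 (s≤s z≤n)) (Σ<-cong n (λ k k<n → f≡g (suc k) (s≤s k<n)))

Σ<-+ : ∀ n f g → Σ[ k < n ] (f k + g k) ≡ Σ< n f + Σ< n g
Σ<-+ zero    f g = sym (+-identityʳ 0ℚ)
Σ<-+ (suc n) f g = trans (cong ((f 0 + g 0) +_) (Σ<-+ n _ _))
  (solve 4 (λ a b c d → (a :+ b) :+ (c :+ d) := (a :+ c) :+ (b :+ d)) refl (f 0) (g 0) (Σ< n _) (Σ< n _))

Σ<-*ˡ : ∀ n c f → Σ[ k < n ] (c * f k) ≡ c * Σ< n f
Σ<-*ˡ zero    c f = sym (*-zeroʳ c)
Σ<-*ˡ (suc n) c f = trans (cong ((c * f 0) +_) (Σ<-*ˡ n c _)) (sym (*-distribˡ-+ c (f 0) _))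

Σ<-neg : ∀ n f → Σ[ k < n ] (- f k) ≡ - Σ< n f
Σ<-neg zero    f = refl
Σ<-neg (suc n) f = trans (cong ((- f 0) +_) (Σ<-neg n _)) (sym (neg-distrib-+ (f 0) _))

Σ<-reverse : ∀ n f → Σ[ k < n ] f (n ∸ suc k) ≡ Σ< n f
Σ<-reverse zero    f = refl
Σ<-reverse (suc n) f = trans (cong (f n +_) (Σ<-reverse n f)) (trans (+-comm (f n) (Σ< n f)) (sym (Σ<-snoc n f)))

Σ<-split : ∀ m n f → Σ< (m ℕ.+ n) f ≡ Σ< m f + Σ[ k < n ] f (m ℕ.+ k)
Σ<-split zero    n f = sym (+-identityˡ _)
Σ<-split (suc m) n f = trans (cong (f 0 +_) (Σ<-split m n _)) (sym (+-assoc (f 0) _ _))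

Σ<-evenOdd : ∀ n f → Σ< (n ℕ.+ n) f ≡ Σ[ k < n ] f (k ℕ.+ k) + Σ[ k < n ] f (suc (k ℕ.+ k))
Σ<-evenOdd zero    f = sym (+-identityˡ 0ℚ)
Σ<-evenOdd (suc n) f = begin
  f 0 + Σ< (n ℕ.+ suc n) (λ k → f (suc k))
    ≡⟨ cong (λ m → f 0 + Σ< m (λ k → f (suc k))) (ℕ.+-suc n n) ⟩
  f 0 + (f 1 + Σ< (n ℕ.+ n) (λ k → f (suc (suc k))))
    ≡⟨ cong (λ s → f 0 + (f 1 + s)) (Σ<-evenOdd n (λ k → f (suc (suc k)))) ⟩
  f 0 + (f 1 + (Σ[ k < n ] f (suc (suc (k ℕ.+ k))) + Σ[ k < n ] f (suc (suc (suc (k ℕ.+ k))))))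
    ≡⟨ cong₂ (λ u v → f 0 + (f 1 + (u + v)))
         (Σ<-cong n (λ k _ → cong (λ m → f (suc m)) (sym (ℕ.+-suc k k))))
         (Σ<-cong n (λ k _ → cong (λ m → f (suc (suc m))) (sym (ℕ.+-suc k k)))) ⟩
  f 0 + (f 1 + (Σ[ k < n ] f (suc k ℕ.+ suc k) + Σ[ k < n ] f (suc (suc k ℕ.+ suc k))))
    ≡⟨ solve 4 (λ a b c d → a :+ (b :+ (c :+ d)) := (a :+ c) :+ (b :+ d)) refl (f 0) (f 1) _ _ ⟩
  (f 0 + Σ[ k < n ] f (suc k ℕ.+ suc k)) + (f 1 + Σ[ k < n ] f (suc (suc k ℕ.+ suc k))) ∎
  where open ≡-Reasoning

Π<-cong : ∀ n {f g} → (∀ k → k < n → f k ≡ g k) → Π< n f ≡ Π< n g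
Π<-cong zero    f≡g = refl
Π<-cong (suc n) f≡g = cong₂ _*_ (Π<-cong n (λ k k<n → f≡g k (ℕ.m<n⇒m<1+n k<n))) (f≡g n ℕ.≤-refl)

Π<-* : ∀ n f g → Π[ k < n ] (f k * g k) ≡ Π< n f * Π< n g
Π<-* zero    f g = refl
Π<-* (suc n) f g = trans (cong (_* (f n * g n)) (Π<-* n f g))
  (solve 4 (λ a b c d → (a :* b) :* (c :* d) := (a :* c) :* (b :* d)) refl (Π< n f) (Π< n g) (f n) (g n))

poch≡Π< : ∀ a k → poch a k ≡ Π[ j < k ] (a + nq j)
poch≡Π< a zero    = refl
poch≡Π< a (suc k) = cong (_* (a + nq k)) (poch≡Π< a k)

fact≡nq! : ∀ k → fact k ≡ nq (k !)
fact≡nq! zero    = refl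
fact≡nq! (suc k) = begin
  fact k * (1ℚ + nq k)   ≡⟨ cong₂ _*_ (fact≡nq! k) (sym (nq-+ 1 k)) ⟩
  nq (k !) * nq (suc k)  ≡⟨ sym (nq-* (k !) (suc k)) ⟩
  nq (k ! ℕ.* suc k)     ≡⟨ cong nq (ℕ.*-comm (k !) (suc k)) ⟩
  nq (suc k !)           ∎
  where open ≡-Reasoning

nCk*fact*fact≡fact : ∀ {n k} → k ≤ n → nq (n C k) * (fact k * fact (n ∸ k)) ≡ fact n
nCk*fact*fact≡fact {n} {k} k≤n = begin
  nq (n C k) * (fact k * fact (n ∸ k))        ≡⟨ cong (λ z → nq (n C k) * z) (cong₂ _*_ (fact≡nq! k) (fact≡nq! (n ∸ k))) ⟩
  nq (n C k) * (nq (k !) * nq ((n ∸ k) !))   ≡⟨ cong (nq (n C k) *_) (sym (nq-* (k !) ((n ∸ k) !))) ⟩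
  nq (n C k) * nq (k ! ℕ.* (n ∸ k) !)        ≡⟨ sym (nq-* (n C k) _) ⟩
  nq ((n C k) ℕ.* (k ! ℕ.* (n ∸ k) !))         ≡⟨ cong nq nCk*k!*[n∸k]!≡n! ⟩
  nq (n !)                                   ≡⟨ sym (fact≡nq! n) ⟩
  fact n                                     ∎
  where
  open ≡-Reasoning
  instance _ = k ℕ.!* (n ∸ k) !≢0
  nCk*k!*[n∸k]!≡n! : (n C k) ℕ.* (k ! ℕ.* (n ∸ k) !) ≡ n !
  nCk*k!*[n∸k]!≡n! = trans (cong (ℕ._* (k ! ℕ.* (n ∸ k) !)) (nCk≡n!/k![n-k]! k≤n)) (m/n*n≡m (k![n∸k]!∣n! k≤n))

first-order-step : ∀ P s c δ → c ⁻¹ * c ≡ 1ℚ →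
  (P * (1ℚ + δ * s)) * (c + δ) - (P * c) * (1ℚ + δ * (s + c ⁻¹)) ≡ (δ * δ) * (P * s)
first-order-step P s c δ c⁻¹c≡1 = begin
  (P * (1ℚ + δ * s)) * (c + δ) - (P * c) * (1ℚ + δ * (s + c ⁻¹))
    ≡⟨ solve 5 (λ P s c i δ → (P :* (con 1ℚ :+ δ :* s)) :* (c :+ δ) :- (P :* c) :* (con 1ℚ :+ δ :* (s :+ i))
                             := (δ :* δ) :* (P :* s) :+ P :* δ :* (con 1ℚ :- i :* c)) refl P s c (c ⁻¹) δ ⟩
  (δ * δ) * (P * s) + P * δ * (1ℚ - c ⁻¹ * c)
    ≡⟨ cong (λ t → (δ * δ) * (P * s) + P * δ * (1ℚ - t)) c⁻¹c≡1 ⟩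
  (δ * δ) * (P * s) + P * δ * (1ℚ - 1ℚ)
    ≡⟨ solve 3 (λ u P δ → u :+ P :* δ :* (con 1ℚ :- con 1ℚ) := u) refl ((δ * δ) * (P * s)) P δ ⟩
  (δ * δ) * (P * s) ∎
  where open ≡-Reasoning

second-order-remainder : ∀ a b r ε σ τ → r * b ≡ a →
  (a * a) * ((a * a) * (1ℚ + - ε * σ)) - (r * r * r * r * (1ℚ - ε * (σ + τ))) * ((b * b) * ((b * b) * (1ℚ + ε * τ)))
    ≡ ((a * a) * (a * a)) * ((ε * ε) * (τ * (σ + τ)))
second-order-remainder .(r * b) b r ε σ τ refl =
  solve 5 (λ b r ε σ τ → ((r :* b) :* (r :* b)) :* (((r :* b) :* (r :* b)) :* (con 1ℚ :+ :- ε :* σ))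
                          :- (r :* r :* r :* r :* (con 1ℚ :- ε :* (σ :+ τ))) :* ((b :* b) :* ((b :* b) :* (con 1ℚ :+ ε :* τ)))
                        := (((r :* b) :* (r :* b)) :* ((r :* b) :* (r :* b))) :* ((ε :* ε) :* (τ :* (σ :+ τ))))
    refl b r ε σ τ

module pAdic (p : ℕ) (p-prime : Prime p) where

  instance
    p≢0 : ℕ.NonZero p
    p≢0 = prime⇒nonZero p-prime

  1<p : 1 < p
  1<p = ℕ.nonTrivial⇒n>1 p {{prime⇒nonTrivial p-prime}}

  p∤_ : ℤ → Set
  p∤ a = ¬ (ℤ.+ p ℤ∣.∣ a)

  p∤-* : ∀ {a b} → p∤ a → p∤ b → p∤ (a ℤ.* b)
  p∤-* {a} {b} p∤a p∤b p∣ab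
    with euclidsLemma ℤ.∣ a ∣ ℤ.∣ b ∣ p-prime (subst (p ℕ∣.∣_) (ℤ.abs-* a b) (ℤ∣.∣⇒∣ᵤ p∣ab))
  ... | inj₁ p∣a = p∤a (ℤ∣.∣ᵤ⇒∣ p∣a)
  ... | inj₂ p∣b = p∤b (ℤ∣.∣ᵤ⇒∣ p∣b)

  p∤-small : ∀ k → 0 < k → k < p → p∤ (ℤ.+ k)
  p∤-small (suc k) _ k<p p∣k = ℕ.<⇒≱ k<p (ℕ∣.∣⇒≤ (ℤ∣.∣⇒∣ᵤ p∣k))

  p∤1 : p∤ ℤ.1ℤ
  p∤1 = p∤-small 1 (s≤s z≤n) 1<p

  p∤⇒≢0 : ∀ {a} → p∤ a → a ≢ ℤ.0ℤ
  p∤⇒≢0 p∤a refl = p∤a (ℤ∣.∣ᵤ⇒∣ (ℕ∣.divides 0 refl))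

  p^k∣m*n∧p∤n⇒p^k∣m : ∀ k m n → (p ℕ.^ k) ℕ∣.∣ m ℕ.* n → ¬ p ℕ∣.∣ n → (p ℕ.^ k) ℕ∣.∣ m
  p^k∣m*n∧p∤n⇒p^k∣m zero    m n _ _ = ℕ∣.1∣ m
  p^k∣m*n∧p∤n⇒p^k∣m (suc k) m n p^k+1∣mn p∤n
    with euclidsLemma m n p-prime (ℕ∣.m*n∣⇒m∣ p (p ℕ.^ k) p^k+1∣mn)
  ... | inj₂ p∣n = ⊥-elim (p∤n p∣n)
  ... | inj₁ (ℕ∣.divides q refl) =
    subst ((p ℕ.^ suc k) ℕ∣.∣_) (ℕ.*-comm p q) (ℕ∣.*-monoʳ-∣ p (p^k∣m*n∧p∤n⇒p^k∣m k q n p^k∣qn p∤n))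
    where
    p^k∣qn : (p ℕ.^ k) ℕ∣.∣ q ℕ.* n
    p^k∣qn = ℕ∣.*-cancelˡ-∣ p (subst ((p ℕ.^ suc k) ℕ∣.∣_)
      (trans (cong (ℕ._* n) (ℕ.*-comm q p)) (ℕ.*-assoc p q n)) p^k+1∣mn)

  pow : ℕ → ℚ
  pow m = nq (p ℕ.^ m)

  pow-+ : ∀ m k → pow (m ℕ.+ k) ≡ pow m * pow k
  pow-+ m k = trans (cong nq (ℕ.^-distribˡ-+-* p m k)) (nq-* (p ℕ.^ m) (p ℕ.^ k))

  -- Divisibility by pᵐ in the localisation ℤ₍ₚ₎.
  record p^_∣_ (m : ℕ) (x : ℚ) : Set where
    constructor witness
    field
      num den      : ℤ
      p∤den        : p∤ den
      x*den≡pᵐ*num : x * fromℤ den ≡ pow m * fromℤ num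

  record Unit (x : ℚ) : Set where
    constructor unit
    field
      num den   : ℤ
      p∤num     : p∤ num
      p∤den     : p∤ den
      x*den≡num : x * fromℤ den ≡ fromℤ num

  ∣-+ : ∀ {m x y} → p^ m ∣ x → p^ m ∣ y → p^ m ∣ (x + y)
  ∣-+ {m} {x} {y} (witness a b p∤b ex) (witness c d p∤d ey) =
    witness (a ℤ.* d ℤ.+ c ℤ.* b) (b ℤ.* d) (p∤-* p∤b p∤d) (begin
      (x + y) * fromℤ (b ℤ.* d)
        ≡⟨ cong ((x + y) *_) (fromℤ-* b d) ⟩
      (x + y) * (fromℤ b * fromℤ d)
        ≡⟨ solve 4 (λ x y b d → (x :+ y) :* (b :* d) := (x :* b) :* d :+ (y :* d) :* b) refl x y (fromℤ b) (fromℤ d) ⟩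
      (x * fromℤ b) * fromℤ d + (y * fromℤ d) * fromℤ b
        ≡⟨ cong₂ (λ u v → u * fromℤ d + v * fromℤ b) ex ey ⟩
      (pow m * fromℤ a) * fromℤ d + (pow m * fromℤ c) * fromℤ b
        ≡⟨ solve 5 (λ π a b c d → (π :* a) :* d :+ (π :* c) :* b := π :* (a :* d :+ c :* b)) refl
             (pow m) (fromℤ a) (fromℤ b) (fromℤ c) (fromℤ d) ⟩
      pow m * (fromℤ a * fromℤ d + fromℤ c * fromℤ b)
        ≡⟨ cong (pow m *_) (sym (trans (fromℤ-+ (a ℤ.* d) (c ℤ.* b)) (cong₂ _+_ (fromℤ-* a d) (fromℤ-* c b)))) ⟩
      pow m * fromℤ (a ℤ.* d ℤ.+ c ℤ.* b) ∎)
    where open ≡-Reasoning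

  ∣-neg : ∀ {m x} → p^ m ∣ x → p^ m ∣ (- x)
  ∣-neg {m} {x} (witness a b p∤b ex) = witness (ℤ.- a) b p∤b (begin
    (- x) * fromℤ b    ≡⟨ sym (neg-distribˡ-* x (fromℤ b)) ⟩
    - (x * fromℤ b)    ≡⟨ cong -_ ex ⟩
    - (pow m * fromℤ a) ≡⟨ neg-distribʳ-* (pow m) (fromℤ a) ⟩
    pow m * - fromℤ a  ≡⟨ cong (pow m *_) (sym (fromℤ-neg a)) ⟩
    pow m * fromℤ (ℤ.- a) ∎)
    where open ≡-Reasoning

  ∣-sub : ∀ {m x y} → p^ m ∣ x → p^ m ∣ y → p^ m ∣ (x - y)
  ∣-sub x y = ∣-+ x (∣-neg y)

  ∣-* : ∀ {m k x y} → p^ m ∣ x → p^ k ∣ y → p^ (m ℕ.+ k) ∣ (x * y)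
  ∣-* {m} {k} {x} {y} (witness a b p∤b ex) (witness c d p∤d ey) =
    witness (a ℤ.* c) (b ℤ.* d) (p∤-* p∤b p∤d) (begin
      (x * y) * fromℤ (b ℤ.* d)
        ≡⟨ cong ((x * y) *_) (fromℤ-* b d) ⟩
      (x * y) * (fromℤ b * fromℤ d)
        ≡⟨ solve 4 (λ x y b d → (x :* y) :* (b :* d) := (x :* b) :* (y :* d)) refl x y (fromℤ b) (fromℤ d) ⟩
      (x * fromℤ b) * (y * fromℤ d)
        ≡⟨ cong₂ _*_ ex ey ⟩
      (pow m * fromℤ a) * (pow k * fromℤ c)
        ≡⟨ solve 4 (λ π a ρ c → (π :* a) :* (ρ :* c) := (π :* ρ) :* (a :* c)) refl (pow m) (fromℤ a) (pow k) (fromℤ c) ⟩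
      (pow m * pow k) * (fromℤ a * fromℤ c)
        ≡⟨ cong₂ _*_ (sym (pow-+ m k)) (sym (fromℤ-* a c)) ⟩
      pow (m ℕ.+ k) * fromℤ (a ℤ.* c) ∎)
    where open ≡-Reasoning

  ∣-*ʳ : ∀ {m x y} → p^ m ∣ x → p^ 0 ∣ y → p^ m ∣ (x * y)
  ∣-*ʳ {m} {x} {y} x∣ y∣ = subst (p^_∣ (x * y)) (ℕ.+-identityʳ m) (∣-* x∣ y∣)

  ∣-weaken : ∀ k {j x} → p^ (k ℕ.+ j) ∣ x → p^ k ∣ x
  ∣-weaken k {j} {x} (witness a b p∤b ex) = witness (ℤ.+ (p ℕ.^ j) ℤ.* a) b p∤b (begin
    x * fromℤ b                          ≡⟨ ex ⟩
    pow (k ℕ.+ j) * fromℤ a              ≡⟨ cong (_* fromℤ a) (pow-+ k j) ⟩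
    (pow k * pow j) * fromℤ a            ≡⟨ *-assoc (pow k) (pow j) (fromℤ a) ⟩
    pow k * (pow j * fromℤ a)            ≡⟨ cong (pow k *_) (sym (fromℤ-* (ℤ.+ (p ℕ.^ j)) a)) ⟩
    pow k * fromℤ (ℤ.+ (p ℕ.^ j) ℤ.* a) ∎)
    where open ≡-Reasoning

  ∣-fromℤ : ∀ a → p^ 0 ∣ fromℤ a
  ∣-fromℤ a = witness a ℤ.1ℤ p∤1 (trans (*-identityʳ (fromℤ a)) (sym (*-identityˡ (fromℤ a))))

  ∣-nq : ∀ k → p^ 0 ∣ nq k
  ∣-nq k = ∣-fromℤ (ℤ.+ k)

  ∣-0 : ∀ {m} → p^ m ∣ 0ℚ
  ∣-0 {m} = witness ℤ.0ℤ ℤ.1ℤ p∤1 (trans (*-zeroˡ 1ℚ) (sym (*-zeroʳ (pow m))))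

  p^1∣p : p^ 1 ∣ nq p
  p^1∣p = witness ℤ.1ℤ ℤ.1ℤ p∤1 (cong (λ z → nq z * 1ℚ) (sym (ℕ.*-identityʳ p)))

  ∣-÷ : ∀ {m x y q} → p^ m ∣ x → Unit y → q * y ≡ x → p^ m ∣ q
  ∣-÷ {m} {x} {y} {q} (witness a b p∤b ex) (unit c d p∤c p∤d ey) qy≡x =
    witness (a ℤ.* d) (c ℤ.* b) (p∤-* p∤c p∤b) (begin
      q * fromℤ (c ℤ.* b)               ≡⟨ cong (q *_) (trans (fromℤ-* c b) (cong (_* fromℤ b) (sym ey))) ⟩
      q * ((y * fromℤ d) * fromℤ b)     ≡⟨ solve 4 (λ q y d b → q :* ((y :* d) :* b) := ((q :* y) :* b) :* d) refl
                                             q y (fromℤ d) (fromℤ b) ⟩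
      ((q * y) * fromℤ b) * fromℤ d     ≡⟨ cong (λ u → (u * fromℤ b) * fromℤ d) qy≡x ⟩
      (x * fromℤ b) * fromℤ d           ≡⟨ cong (_* fromℤ d) ex ⟩
      (pow m * fromℤ a) * fromℤ d       ≡⟨ *-assoc (pow m) (fromℤ a) (fromℤ d) ⟩
      pow m * (fromℤ a * fromℤ d)       ≡⟨ cong (pow m *_) (sym (fromℤ-* a d)) ⟩
      pow m * fromℤ (a ℤ.* d)           ∎)
    where open ≡-Reasoning

  ∣⇒≡[modℚ] : ∀ {m} x y → p^ m ∣ (x - y) → x ≡ y [modℚ p ^ m ]
  ∣⇒≡[modℚ] {m} x y (witness a b p∤b ex) = numerator , denominator
    where
    open ≡-Reasoning
    z : ℚ
    z = x - y
    ↥z*b≡pᵐa*↧z : ↥ z ℤ.* b ≡ (ℤ.+ (p ℕ.^ m) ℤ.* a) ℤ.* ↧ z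
    ↥z*b≡pᵐa*↧z = fromℤ-injective _ _ (begin
      fromℤ (↥ z ℤ.* b)                          ≡⟨ fromℤ-* (↥ z) b ⟩
      fromℤ (↥ z) * fromℤ b                       ≡⟨ cong (_* fromℤ b) (sym (x*↧x≡↥x z)) ⟩
      (z * fromℤ (↧ z)) * fromℤ b                 ≡⟨ solve 3 (λ z d b → (z :* d) :* b := (z :* b) :* d) refl z (fromℤ (↧ z)) (fromℤ b) ⟩
      (z * fromℤ b) * fromℤ (↧ z)                 ≡⟨ cong (_* fromℤ (↧ z)) ex ⟩
      (pow m * fromℤ a) * fromℤ (↧ z)             ≡⟨ sym (trans (fromℤ-* (ℤ.+ (p ℕ.^ m) ℤ.* a) (↧ z))
                                                         (cong (_* fromℤ (↧ z)) (fromℤ-* (ℤ.+ (p ℕ.^ m)) a))) ⟩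
      fromℤ ((ℤ.+ (p ℕ.^ m) ℤ.* a) ℤ.* ↧ z)      ∎)
    ∣↥z∣*∣b∣≡pᵐ∣a∣*↧z : ℤ.∣ ↥ z ∣ ℕ.* ℤ.∣ b ∣ ≡ ((p ℕ.^ m) ℕ.* ℤ.∣ a ∣) ℕ.* ↧ₙ z
    ∣↥z∣*∣b∣≡pᵐ∣a∣*↧z = trans (sym (ℤ.abs-* (↥ z) b)) (trans (cong ℤ.∣_∣ ↥z*b≡pᵐa*↧z)
      (trans (ℤ.abs-* (ℤ.+ (p ℕ.^ m) ℤ.* a) (↧ z)) (cong (ℕ._* ↧ₙ z) (ℤ.abs-* (ℤ.+ (p ℕ.^ m)) a))))
    numerator : (p ℕ.^ m) ℕ∣.∣ ℤ.∣ ↥ z ∣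
    numerator = p^k∣m*n∧p∤n⇒p^k∣m m ℤ.∣ ↥ z ∣ ℤ.∣ b ∣
      (subst ((p ℕ.^ m) ℕ∣.∣_) (sym ∣↥z∣*∣b∣≡pᵐ∣a∣*↧z) (ℕ∣.∣m⇒∣m*n (↧ₙ z) (ℕ∣.m∣m*n ℤ.∣ a ∣)))
      (λ p∣b → p∤b (ℤ∣.∣ᵤ⇒∣ p∣b))
    -- ↧z is coprime to ↥z, so it divides |b|.
    denominator : ¬ p ℕ∣.∣ ↧ₙ z
    denominator p∣↧z = p∤b (ℤ∣.∣ᵤ⇒∣ (ℕ∣.∣-trans p∣↧z (Coprimality.coprime-divisor
      (↧-coprime-↥ z)
      (subst (↧ₙ z ℕ∣.∣_) (sym ∣↥z∣*∣b∣≡pᵐ∣a∣*↧z) (ℕ∣.n∣m*n ((p ℕ.^ m) ℕ.* ℤ.∣ a ∣))))))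

  Unit-* : ∀ {x y} → Unit x → Unit y → Unit (x * y)
  Unit-* {x} {y} (unit a b p∤a p∤b ex) (unit c d p∤c p∤d ey) =
    unit (a ℤ.* c) (b ℤ.* d) (p∤-* p∤a p∤c) (p∤-* p∤b p∤d) (begin
      (x * y) * fromℤ (b ℤ.* d)     ≡⟨ cong ((x * y) *_) (fromℤ-* b d) ⟩
      (x * y) * (fromℤ b * fromℤ d) ≡⟨ solve 4 (λ x y b d → (x :* y) :* (b :* d) := (x :* b) :* (y :* d)) refl
                                         x y (fromℤ b) (fromℤ d) ⟩
      (x * fromℤ b) * (y * fromℤ d) ≡⟨ cong₂ _*_ ex ey ⟩
      fromℤ a * fromℤ c             ≡⟨ sym (fromℤ-* a c) ⟩
      fromℤ (a ℤ.* c)               ∎)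
    where open ≡-Reasoning

  Unit-÷ : ∀ {x y q} → Unit x → Unit y → q * y ≡ x → Unit q
  Unit-÷ {x} {y} {q} (unit a b p∤a p∤b ex) (unit c d p∤c p∤d ey) qy≡x =
    unit (a ℤ.* d) (c ℤ.* b) (p∤-* p∤a p∤d) (p∤-* p∤c p∤b) (begin
      q * fromℤ (c ℤ.* b)           ≡⟨ cong (q *_) (trans (fromℤ-* c b) (cong (_* fromℤ b) (sym ey))) ⟩
      q * ((y * fromℤ d) * fromℤ b) ≡⟨ solve 4 (λ q y d b → q :* ((y :* d) :* b) := ((q :* y) :* b) :* d) refl
                                         q y (fromℤ d) (fromℤ b) ⟩
      ((q * y) * fromℤ b) * fromℤ d ≡⟨ cong (λ u → (u * fromℤ b) * fromℤ d) qy≡x ⟩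
      (x * fromℤ b) * fromℤ d       ≡⟨ cong (_* fromℤ d) ex ⟩
      fromℤ a * fromℤ d             ≡⟨ sym (fromℤ-* a d) ⟩
      fromℤ (a ℤ.* d)               ∎)
    where open ≡-Reasoning

  Unit-fromℤ : ∀ {a} → p∤ a → Unit (fromℤ a)
  Unit-fromℤ {a} p∤a = unit a ℤ.1ℤ p∤a p∤1 (*-identityʳ (fromℤ a))

  Unit-nq : ∀ k → 0 < k → k < p → Unit (nq k)
  Unit-nq k 0<k k<p = Unit-fromℤ (p∤-small k 0<k k<p)

  Unit-1 : Unit 1ℚ
  Unit-1 = Unit-fromℤ p∤1

  Unit⇒∣ : ∀ {x} → Unit x → p^ 0 ∣ x
  Unit⇒∣ {x} (unit a b _ p∤b ex) = witness a b p∤b (trans ex (sym (*-identityˡ (fromℤ a))))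

  Unit⇒≢0 : ∀ {x} → Unit x → x ≢ 0ℚ
  Unit⇒≢0 {x} (unit a b p∤a _ ex) x≡0 =
    p∤⇒≢0 p∤a (fromℤ≡0⇒≡0 a (trans (sym ex) (trans (cong (_* fromℤ b) x≡0) (*-zeroˡ (fromℤ b)))))

  Unit-⁻¹ : ∀ {x} → Unit x → Unit (x ⁻¹)
  Unit-⁻¹ {x} ux = Unit-÷ Unit-1 ux (x⁻¹*x≡1 x (Unit⇒≢0 ux))

  infix 4 _≈[_]_
  record _≈[_]_ (x : ℚ) (m : ℕ) (y : ℚ) : Set where
    constructor congruent
    field difference : p^ m ∣ (x - y)
  open _≈[_]_ public

  ≈-reflexive : ∀ {m x y} → x ≡ y → x ≈[ m ] y
  ≈-reflexive {x = x} refl = congruent (subst (p^ _ ∣_) (sym (+-inverseʳ x)) ∣-0)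

  ≈-refl : ∀ {m x} → x ≈[ m ] x
  ≈-refl = ≈-reflexive refl

  ≈-sym : ∀ {m x y} → x ≈[ m ] y → y ≈[ m ] x
  ≈-sym {x = x} {y} (congruent d) =
    congruent (subst (p^ _ ∣_) (solve 2 (λ x y → :- (x :- y) := y :- x) refl x y) (∣-neg d))

  ≈-trans : ∀ {m x y z} → x ≈[ m ] y → y ≈[ m ] z → x ≈[ m ] z
  ≈-trans {x = x} {y} {z} (congruent d) (congruent e) =
    congruent (subst (p^ _ ∣_) (solve 3 (λ x y z → (x :- y) :+ (y :- z) := x :- z) refl x y z) (∣-+ d e))

  ≈-setoid : ℕ → Setoid 0ℓ 0ℓ
  ≈-setoid m = record
    { _≈_ = _≈[ m ]_
    ; isEquivalence = record { refl = ≈-refl ; sym = ≈-sym ; trans = ≈-trans }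
    }

  module ≈-Reasoning (m : ℕ) = SetoidReasoning (≈-setoid m)

  ≈-+ : ∀ {m x x′ y y′} → x ≈[ m ] x′ → y ≈[ m ] y′ → x + y ≈[ m ] x′ + y′
  ≈-+ {x = x} {x′} {y} {y′} (congruent d) (congruent e) = congruent (subst (p^ _ ∣_)
    (solve 4 (λ x x′ y y′ → (x :- x′) :+ (y :- y′) := (x :+ y) :- (x′ :+ y′)) refl x x′ y y′) (∣-+ d e))

  ≈-* : ∀ {m x x′ y y′} → x ≈[ m ] x′ → y ≈[ m ] y′ → p^ 0 ∣ x′ → p^ 0 ∣ y → x * y ≈[ m ] x′ * y′
  ≈-* {x = x} {x′} {y} {y′} (congruent d) (congruent e) x′∣ y∣ = congruent (subst (p^ _ ∣_)
    (solve 4 (λ x x′ y y′ → (x :- x′) :* y :+ x′ :* (y :- y′) := (x :* y) :- (x′ :* y′)) refl x x′ y y′)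
    (∣-+ (∣-*ʳ d y∣) (∣-* x′∣ e)))

  ≈-weaken : ∀ k {j x y} → x ≈[ k ℕ.+ j ] y → x ≈[ k ] y
  ≈-weaken k (congruent d) = congruent (∣-weaken k d)

  ≈-÷ : ∀ {m x x′ y y′ q q′} → x ≈[ m ] x′ → y ≈[ m ] y′ → Unit y → Unit y′ → p^ 0 ∣ x′ →
        q * y ≡ x → q′ * y′ ≡ x′ → q ≈[ m ] q′
  ≈-÷ {m} {x} {x′} {y} {y′} {q} {q′} (congruent d) y≈y′ uy uy′ x′∣ qy≡x q′y′≡x′ =
    congruent (∣-÷ (∣-+ (∣-*ʳ d (Unit⇒∣ uy′)) (∣-* x′∣ (difference (≈-sym y≈y′)))) (Unit-* uy uy′) (begin
      (q - q′) * (y * y′)             ≡⟨ solve 4 (λ q q′ y y′ → (q :- q′) :* (y :* y′) := (q :* y) :* y′ :- (q′ :* y′) :* y) refl q q′ y y′ ⟩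
      (q * y) * y′ - (q′ * y′) * y    ≡⟨ cong₂ (λ u v → u * y′ - v * y) qy≡x q′y′≡x′ ⟩
      x * y′ - x′ * y                 ≡⟨ solve 4 (λ x x′ y y′ → x :* y′ :- x′ :* y := (x :- x′) :* y′ :+ x′ :* (y′ :- y)) refl x x′ y y′ ⟩
      (x - x′) * y′ + x′ * (y′ - y)   ∎))
    where open ≡-Reasoning

  ≈-⁻¹ : ∀ {m y y′} → Unit y → Unit y′ → y ≈[ m ] y′ → y ⁻¹ ≈[ m ] y′ ⁻¹
  ≈-⁻¹ {y = y} {y′} uy uy′ y≈y′ =
    ≈-÷ ≈-refl y≈y′ uy uy′ (∣-nq 1) (x⁻¹*x≡1 y (Unit⇒≢0 uy)) (x⁻¹*x≡1 y′ (Unit⇒≢0 uy′))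

  ∣-≈ : ∀ {m x y} → x ≈[ m ] y → p^ m ∣ y → p^ m ∣ x
  ∣-≈ {m} {x} {y} (congruent d) y∣ = subst (p^ m ∣_) (solve 2 (λ x y → y :+ (x :- y) := x) refl x y) (∣-+ y∣ d)

  Unit-≈ : ∀ {x y} → x ≈[ 1 ] y → Unit y → Unit x
  Unit-≈ {x} {y} (congruent (witness f e p∤e ef)) (unit c d p∤c p∤d ey) =
    unit (c ℤ.* e ℤ.+ (ℤ.+ p ℤ.* f) ℤ.* d) (d ℤ.* e) p∤num (p∤-* p∤d p∤e) (begin
      x * fromℤ (d ℤ.* e)
        ≡⟨ cong (x *_) (fromℤ-* d e) ⟩
      x * (fromℤ d * fromℤ e)
        ≡⟨ solve 4 (λ x y d e → x :* (d :* e) := (y :* d) :* e :+ ((x :- y) :* e) :* d) refl x y (fromℤ d) (fromℤ e) ⟩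
      (y * fromℤ d) * fromℤ e + ((x - y) * fromℤ e) * fromℤ d
        ≡⟨ cong₂ (λ u v → u * fromℤ e + v * fromℤ d) ey ef ⟩
      fromℤ c * fromℤ e + (pow 1 * fromℤ f) * fromℤ d
        ≡⟨ cong (λ π → fromℤ c * fromℤ e + (π * fromℤ f) * fromℤ d) (cong nq (ℕ.*-identityʳ p)) ⟩
      fromℤ c * fromℤ e + (nq p * fromℤ f) * fromℤ d
        ≡⟨ sym (trans (fromℤ-+ (c ℤ.* e) ((ℤ.+ p ℤ.* f) ℤ.* d)) (cong₂ _+_ (fromℤ-* c e)
             (trans (fromℤ-* (ℤ.+ p ℤ.* f) d) (cong (_* fromℤ d) (fromℤ-* (ℤ.+ p) f))))) ⟩
      fromℤ (c ℤ.* e ℤ.+ (ℤ.+ p ℤ.* f) ℤ.* d) ∎)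
    where
    open ≡-Reasoning
    p∤num : p∤ (c ℤ.* e ℤ.+ (ℤ.+ p ℤ.* f) ℤ.* d)
    p∤num p∣ = p∤-* p∤c p∤e (ℤ∣.∣m+n∣n⇒∣m p∣ (ℤ∣.∣m⇒∣m*n d (ℤ∣.∣m⇒∣m*n f ℤ∣.∣-refl)))

  Unit-1+ : ∀ {x} → p^ 1 ∣ x → Unit (1ℚ + x)
  Unit-1+ {x} p∣x = Unit-≈ (congruent (subst (p^ 1 ∣_) (solve 1 (λ x → x := (con 1ℚ :+ x) :- con 1ℚ) refl x) p∣x)) Unit-1

  squares-≈ : ∀ {a b} → p^ 1 ∣ (a + b) → p^ 0 ∣ a → p^ 0 ∣ b → a * a ≈[ 1 ] b * b
  squares-≈ {a} {b} p∣a+b a∣ b∣ = congruent (subst (p^ 1 ∣_)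
    (solve 2 (λ a b → (a :+ b) :* (a :- b) := a :* a :- b :* b) refl a b) (∣-*ʳ p∣a+b (∣-sub a∣ b∣)))

  Σ<-∣ : ∀ {m} n f → (∀ k → k < n → p^ m ∣ f k) → p^ m ∣ Σ< n f
  Σ<-∣ zero    f f∣ = ∣-0
  Σ<-∣ (suc n) f f∣ = ∣-+ (f∣ 0 (s≤s z≤n)) (Σ<-∣ n (λ k → f (suc k)) (λ k k<n → f∣ (suc k) (s≤s k<n)))

  Σ<-≈ : ∀ {m} n f g → (∀ k → k < n → f k ≈[ m ] g k) → Σ< n f ≈[ m ] Σ< n g
  Σ<-≈ zero    f g f≈g = ≈-refl
  Σ<-≈ (suc n) f g f≈g =
    ≈-+ (f≈g 0 (s≤s z≤n)) (Σ<-≈ n (λ k → f (suc k)) (λ k → g (suc k)) (λ k k<n → f≈g (suc k) (s≤s k<n)))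

  Π<-∣ : ∀ k f → (∀ j → j < k → p^ 0 ∣ f j) → p^ 0 ∣ Π< k f
  Π<-∣ zero    f f∣ = ∣-nq 1
  Π<-∣ (suc k) f f∣ = ∣-* (Π<-∣ k f (λ j j<k → f∣ j (ℕ.m<n⇒m<1+n j<k))) (f∣ k ℕ.≤-refl)

  Π<-Unit : ∀ k f → (∀ j → j < k → Unit (f j)) → Unit (Π< k f)
  Π<-Unit zero    f units = Unit-1
  Π<-Unit (suc k) f units = Unit-* (Π<-Unit k f (λ j j<k → units j (ℕ.m<n⇒m<1+n j<k))) (units k ℕ.≤-refl)

  Π<-first-order : ∀ {m} δ → p^ m ∣ δ → ∀ k a → (∀ j → j < k → Unit (a j)) →
                   Π[ j < k ] (a j + δ) ≈[ m ℕ.+ m ] Π< k a * (1ℚ + δ * Σ[ j < k ] a j ⁻¹)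
  Π<-first-order δ δ∣ zero a units =
    ≈-reflexive (solve 1 (λ δ → con 1ℚ := con 1ℚ :* (con 1ℚ :+ δ :* con 0ℚ)) refl δ)
  Π<-first-order {m} δ δ∣ (suc k) a units = begin
    (Π[ j < k ] (a j + δ)) * (c + δ)
      ≈⟨ ≈-* (Π<-first-order δ δ∣ k a units′) ≈-refl (∣-* P∣ (∣-+ (∣-nq 1) (∣-*ʳ δ∣₀ s∣))) (∣-+ c∣ δ∣₀) ⟩
    (P * (1ℚ + δ * s)) * (c + δ)
      ≈⟨ congruent (subst (p^ _ ∣_) (sym (first-order-step P s c δ (x⁻¹*x≡1 c (Unit⇒≢0 uc))))
           (∣-*ʳ (∣-* δ∣ δ∣) (∣-* P∣ s∣))) ⟩
    (P * c) * (1ℚ + δ * (s + c ⁻¹))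
      ≡⟨ cong (λ t → (P * c) * (1ℚ + δ * t)) (sym (Σ<-snoc k (λ j → a j ⁻¹))) ⟩
    Π< (suc k) a * (1ℚ + δ * Σ[ j < suc k ] a j ⁻¹) ∎
    where
    open ≈-Reasoning (m ℕ.+ m)
    units′ : ∀ j → j < k → Unit (a j)
    units′ j j<k = units j (ℕ.m<n⇒m<1+n j<k)
    P s c : ℚ
    P = Π< k a
    s = Σ[ j < k ] a j ⁻¹
    c = a k
    uc : Unit c
    uc = units k ℕ.≤-refl
    c∣ : p^ 0 ∣ c
    c∣ = Unit⇒∣ uc
    δ∣₀ : p^ 0 ∣ δ
    δ∣₀ = ∣-weaken 0 δ∣
    P∣ : p^ 0 ∣ P
    P∣ = Π<-∣ k a (λ j j<k → Unit⇒∣ (units′ j j<k))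
    s∣ : p^ 0 ∣ s
    s∣ = Σ<-∣ k (λ j → a j ⁻¹) (λ j j<k → Unit⇒∣ (Unit-⁻¹ (units′ j j<k)))

module Supercongruence (n : ℕ) (p-prime : Prime (suc (n ℕ.+ n))) (1<n : 1 < n) where

  p : ℕ
  p = suc (n ℕ.+ n)

  open pAdic p p-prime

  Unit-nq≤2n : ∀ j → 0 < j → j ≤ n ℕ.+ n → Unit (nq j)
  Unit-nq≤2n j 0<j j≤2n = Unit-nq j 0<j (s≤s j≤2n)

  Unit-nq≤n : ∀ j → 0 < j → j ≤ n → Unit (nq j)
  Unit-nq≤n j 0<j j≤n = Unit-nq≤2n j 0<j (ℕ.≤-trans j≤n (ℕ.m≤m+n n n))

  Unit-nq-small : ∀ j → 0 < j → j ≤ 4 → Unit (nq j)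
  Unit-nq-small j 0<j j≤4 = Unit-nq≤2n j 0<j (ℕ.≤-trans j≤4 (ℕ.+-mono-≤ 1<n 1<n))

  Unit-2 : Unit (nq 2)
  Unit-2 = Unit-nq-small 2 (s≤s z≤n) (s≤s (s≤s z≤n))

  Unit-3 : Unit (nq 3)
  Unit-3 = Unit-nq-small 3 (s≤s z≤n) (s≤s (s≤s (s≤s z≤n)))

  Unit-4 : Unit (nq 4)
  Unit-4 = Unit-nq-small 4 (s≤s z≤n) ℕ.≤-refl

  nq-suc : ∀ j → 1ℚ + nq j ≡ nq (suc j)
  nq-suc j = sym (nq-+ 1 j)

  h : ℚ
  h = nq p ÷? nq 2

  ε : ℚ
  ε = (nq p * nq p) ÷? nq 4

  h*2≡p : h * nq 2 ≡ nq p
  h*2≡p = x÷?y*y≡x (nq p) (nq 2) (Unit⇒≢0 Unit-2)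

  h*h≡ε : h * h ≡ ε
  h*h≡ε = q*y≡x⇒q≡x÷?y (nq p * nq p) (nq 4) (h * h) (Unit⇒≢0 Unit-4) (begin
    (h * h) * nq 4               ≡⟨ solve 2 (λ h t → (h :* h) :* (t :* t) := (h :* t) :* (h :* t)) refl h (nq 2) ⟩
    (h * nq 2) * (h * nq 2)      ≡⟨ cong₂ _*_ h*2≡p h*2≡p ⟩
    nq p * nq p                  ∎)
    where open ≡-Reasoning

  p∣h : p^ 1 ∣ h
  p∣h = ∣-÷ p^1∣p Unit-2 h*2≡p

  p²∣ε : p^ 2 ∣ ε
  p²∣ε = subst (p^ 2 ∣_) h*h≡ε (∣-* p∣h p∣h)

  [½+j]*2≡2j+1 : ∀ j → (½ + nq j) * nq 2 ≡ nq (suc (j ℕ.+ j))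
  [½+j]*2≡2j+1 j = begin
    (½ + nq j) * nq 2               ≡⟨ solve 2 (λ a x → (a :+ x) :* (con 1ℚ :+ con 1ℚ) := a :* (con 1ℚ :+ con 1ℚ) :+ (x :+ x)) refl ½ (nq j) ⟩
    ½ * nq 2 + (nq j + nq j)        ≡⟨ cong (1ℚ +_) (sym (nq-+ j j)) ⟩
    1ℚ + nq (j ℕ.+ j)               ≡⟨ nq-suc (j ℕ.+ j) ⟩
    nq (suc (j ℕ.+ j))              ∎
    where open ≡-Reasoning

  ∣-½+ : ∀ j → p^ 0 ∣ (½ + nq j)
  ∣-½+ j = ∣-÷ (∣-nq (suc (j ℕ.+ j))) Unit-2 ([½+j]*2≡2j+1 j)

  Unit-½+ : ∀ j → j < n → Unit (½ + nq j)
  Unit-½+ j j<n = Unit-÷ (Unit-nq≤2n (suc (j ℕ.+ j)) (s≤s z≤n) (ℕ.+-mono-< j<n j<n))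
    Unit-2 ([½+j]*2≡2j+1 j)

  ½+n≡h : ½ + nq n ≡ h
  ½+n≡h = q*y≡x⇒q≡x÷?y (nq p) (nq 2) (½ + nq n)
    (Unit⇒≢0 Unit-2) ([½+j]*2≡2j+1 n)

  invSq : ℕ → ℚ
  invSq m = (nq m * nq m) ⁻¹

  H₂ : ℕ → ℚ
  H₂ k = Σ[ j < k ] invSq (suc j)

  H₂½ : ℕ → ℚ
  H₂½ k = Σ[ j < k ] ((½ + nq j) * (½ + nq j)) ⁻¹

  Unit-[j+1]² : ∀ j → j < n → Unit (nq (suc j) * nq (suc j))
  Unit-[j+1]² j j<n = Unit-* u u
    where
    u : Unit (nq (suc j))
    u = Unit-nq≤n (suc j) (s≤s z≤n) j<n

  Unit-[½+j]² : ∀ j → j < n → Unit ((½ + nq j) * (½ + nq j))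
  Unit-[½+j]² j j<n = Unit-* (Unit-½+ j j<n) (Unit-½+ j j<n)

  ∣-H₂ : ∀ k → k ≤ n → p^ 0 ∣ H₂ k
  ∣-H₂ k k≤n = Σ<-∣ k _ (λ j j<k → Unit⇒∣ (Unit-⁻¹ (Unit-[j+1]² j (ℕ.<-≤-trans j<k k≤n))))

  ∣-H₂½ : ∀ k → k ≤ n → p^ 0 ∣ H₂½ k
  ∣-H₂½ k k≤n = Σ<-∣ k _ (λ j j<k → Unit⇒∣ (Unit-⁻¹ (Unit-[½+j]² j (ℕ.<-≤-trans j<k k≤n))))

  ∣-poch½ : ∀ k → p^ 0 ∣ poch ½ k
  ∣-poch½ k = subst (p^ 0 ∣_) (sym (poch≡Π< ½ k)) (Π<-∣ k _ (λ j _ → ∣-½+ j))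

  Unit-fact : ∀ k → k ≤ n → Unit (fact k)
  Unit-fact k k≤n = subst Unit (sym (poch≡Π< 1ℚ k)) (Π<-Unit k _ (λ j j<k →
    subst Unit (sym (nq-suc j)) (Unit-nq≤n (suc j) (s≤s z≤n) (ℕ.≤-trans j<k k≤n))))

  ∣-fact : ∀ k → p^ 0 ∣ fact k
  ∣-fact k = subst (p^ 0 ∣_) (sym (fact≡nq! k)) (∣-nq (k !))

  poch½² : ∀ k → poch ½ k * poch ½ k ≡ Π[ j < k ] ((½ + nq j) * (½ + nq j))
  poch½² k = trans (cong₂ _*_ (poch≡Π< ½ k) (poch≡Π< ½ k)) (sym (Π<-* k _ _))

  fact² : ∀ k → fact k * fact k ≡ Π[ j < k ] (nq (suc j) * nq (suc j))
  fact² k = trans (cong₂ _*_ (poch≡Π< 1ℚ k) (poch≡Π< 1ℚ k))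
    (trans (sym (Π<-* k _ _)) (Π<-cong k (λ j _ → cong₂ _*_ (nq-suc j) (nq-suc j))))

  poch[½+h]*poch[½-h] : ∀ k → poch (½ + h) k * poch (½ - h) k ≡ Π[ j < k ] ((½ + nq j) * (½ + nq j) + - ε)
  poch[½+h]*poch[½-h] k = begin
    poch (½ + h) k * poch (½ - h) k
      ≡⟨ cong₂ _*_ (poch≡Π< (½ + h) k) (poch≡Π< (½ - h) k) ⟩
    (Π[ j < k ] (½ + h + nq j)) * (Π[ j < k ] (½ - h + nq j))
      ≡⟨ sym (Π<-* k _ _) ⟩
    Π[ j < k ] ((½ + h + nq j) * (½ - h + nq j))
      ≡⟨ Π<-cong k (λ j _ → trans
           (solve 3 (λ a h x → (a :+ h :+ x) :* (a :- h :+ x) := (a :+ x) :* (a :+ x) :+ :- (h :* h)) refl ½ h (nq j))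
           (cong (λ t → (½ + nq j) * (½ + nq j) + - t) h*h≡ε)) ⟩
    Π[ j < k ] ((½ + nq j) * (½ + nq j) + - ε) ∎
    where open ≡-Reasoning

  conjPoch≡Π : ∀ k → conjPoch p k ≡ Π[ j < k ] (nq (suc j) * nq (suc j) + ε)
  conjPoch≡Π zero    = refl
  conjPoch≡Π (suc k) = cong (_* (nq (suc k) * nq (suc k) + ε)) (conjPoch≡Π k)

  poch[½±h]≈ : ∀ k → k ≤ n → poch (½ + h) k * poch (½ - h) k ≈[ 4 ] (poch ½ k * poch ½ k) * (1ℚ + - ε * H₂½ k)
  poch[½±h]≈ k k≤n = begin
    poch (½ + h) k * poch (½ - h) k
      ≡⟨ poch[½+h]*poch[½-h] k ⟩
    Π[ j < k ] ((½ + nq j) * (½ + nq j) + - ε)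
      ≈⟨ Π<-first-order (- ε) (∣-neg p²∣ε) k _ (λ j j<k → Unit-[½+j]² j (ℕ.<-≤-trans j<k k≤n)) ⟩
    (Π[ j < k ] ((½ + nq j) * (½ + nq j))) * (1ℚ + - ε * H₂½ k)
      ≡⟨ cong (_* (1ℚ + - ε * H₂½ k)) (sym (poch½² k)) ⟩
    (poch ½ k * poch ½ k) * (1ℚ + - ε * H₂½ k) ∎
    where open ≈-Reasoning 4

  conjPoch≈ : ∀ k → k ≤ n → conjPoch p k ≈[ 4 ] (fact k * fact k) * (1ℚ + ε * H₂ k)
  conjPoch≈ k k≤n = begin
    conjPoch p k
      ≡⟨ conjPoch≡Π k ⟩
    Π[ j < k ] (nq (suc j) * nq (suc j) + ε)
      ≈⟨ Π<-first-order ε p²∣ε k _ (λ j j<k → Unit-[j+1]² j (ℕ.<-≤-trans j<k k≤n)) ⟩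
    (Π[ j < k ] (nq (suc j) * nq (suc j))) * (1ℚ + ε * H₂ k)
      ≡⟨ cong (_* (1ℚ + ε * H₂ k)) (sym (fact² k)) ⟩
    (fact k * fact k) * (1ℚ + ε * H₂ k) ∎
    where open ≈-Reasoning 4

  ρ : ℕ → ℚ
  ρ k = poch ½ k ÷? fact k

  ρ*fact≡poch½ : ∀ k → k ≤ n → ρ k * fact k ≡ poch ½ k
  ρ*fact≡poch½ k k≤n = x÷?y*y≡x (poch ½ k) (fact k) (Unit⇒≢0 (Unit-fact k k≤n))

  ∣-ρ : ∀ k → k ≤ n → p^ 0 ∣ ρ k
  ∣-ρ k k≤n = ∣-÷ (∣-poch½ k) (Unit-fact k k≤n) (ρ*fact≡poch½ k k≤n)

  lhsNumerator≈ : ∀ k → k ≤ n → poch ½ k * poch ½ k * poch (½ + h) k * poch (½ - h) k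
                                  ≈[ 4 ] (poch ½ k * poch ½ k) * ((poch ½ k * poch ½ k) * (1ℚ + - ε * H₂½ k))
  lhsNumerator≈ k k≤n = begin
    A² * poch (½ + h) k * poch (½ - h) k
      ≡⟨ *-assoc A² (poch (½ + h) k) (poch (½ - h) k) ⟩
    A² * (poch (½ + h) k * poch (½ - h) k)
      ≈⟨ ≈-* ≈-refl (poch[½±h]≈ k k≤n) A²∣
             (∣-≈ (≈-weaken 0 (poch[½±h]≈ k k≤n)) (∣-* A²∣ (∣-+ (∣-nq 1) (∣-*ʳ (∣-weaken 0 (∣-neg p²∣ε)) (∣-H₂½ k k≤n))))) ⟩
    A² * (A² * (1ℚ + - ε * H₂½ k)) ∎
    where
    open ≈-Reasoning 4
    A² : ℚ
    A² = poch ½ k * poch ½ k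
    A²∣ : p^ 0 ∣ A²
    A²∣ = ∣-* (∣-poch½ k) (∣-poch½ k)

  Unit-1+εH₂ : ∀ k → k ≤ n → Unit (1ℚ + ε * H₂ k)
  Unit-1+εH₂ k k≤n = Unit-1+ (∣-weaken 1 (∣-*ʳ p²∣ε (∣-H₂ k k≤n)))

  lhsDenominator≈ : ∀ k → k ≤ n → fact k * fact k * conjPoch p k ≈[ 4 ] (fact k * fact k) * ((fact k * fact k) * (1ℚ + ε * H₂ k))
  lhsDenominator≈ k k≤n = ≈-* ≈-refl (conjPoch≈ k k≤n) B²∣
    (∣-≈ (≈-weaken 0 (conjPoch≈ k k≤n)) (∣-* B²∣ (Unit⇒∣ (Unit-1+εH₂ k k≤n))))
    where
    B²∣ : p^ 0 ∣ (fact k * fact k)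
    B²∣ = ∣-* (∣-fact k) (∣-fact k)

  lhsTerm≈ : ∀ k → k ≤ n → lhsTerm p k ≈[ 4 ] rhsTerm k * (1ℚ - ε * (H₂½ k + H₂ k))
  lhsTerm≈ k k≤n = ≈-÷ N≈R*D′ (lhsDenominator≈ k k≤n) uD uD′ (∣-* R∣ (Unit⇒∣ uD′)) (x÷?y*y≡x _ _ (Unit⇒≢0 uD)) refl
    where
    A B R D′ : ℚ
    A = poch ½ k
    B = fact k
    R = rhsTerm k * (1ℚ - ε * (H₂½ k + H₂ k))
    D′ = (B * B) * ((B * B) * (1ℚ + ε * H₂ k))
    uB² : Unit (B * B)
    uB² = Unit-* (Unit-fact k k≤n) (Unit-fact k k≤n)
    uD′ : Unit D′
    uD′ = Unit-* uB² (Unit-* uB² (Unit-1+εH₂ k k≤n))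
    uD : Unit (B * B * conjPoch p k)
    uD = Unit-≈ (≈-weaken 1 (lhsDenominator≈ k k≤n)) uD′
    R∣ : p^ 0 ∣ R
    R∣ = ∣-* (∣-* (∣-* (∣-* ρ∣ ρ∣) ρ∣) ρ∣) (∣-sub (∣-nq 1) (∣-weaken 0 (∣-*ʳ p²∣ε (∣-+ (∣-H₂½ k k≤n) (∣-H₂ k k≤n)))))
      where
      ρ∣ : p^ 0 ∣ ρ k
      ρ∣ = ∣-ρ k k≤n
    N≈R*D′ : A * A * poch (½ + h) k * poch (½ - h) k ≈[ 4 ] R * D′
    N≈R*D′ = ≈-trans (lhsNumerator≈ k k≤n) (congruent
      (subst (p^ 4 ∣_) (sym (second-order-remainder A B (ρ k) ε (H₂½ k) (H₂ k) (ρ*fact≡poch½ k k≤n)))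
        (∣-* (∣-* A²∣ A²∣) (∣-*ʳ (∣-* p²∣ε p²∣ε) (∣-* (∣-H₂ k k≤n) (∣-+ (∣-H₂½ k k≤n) (∣-H₂ k k≤n)))))))
      where
      A²∣ : p^ 0 ∣ (A * A)
      A²∣ = ∣-* (∣-poch½ k) (∣-poch½ k)

  n∸j≡1+[n∸1+j] : ∀ j → j < n → n ∸ j ≡ suc (n ∸ suc j)
  n∸j≡1+[n∸1+j] j j<n = ℕ.+-∸-assoc 1 j<n

  [½+j]²≈[n-j]² : ∀ j → j ≤ n → (½ + nq j) * (½ + nq j) ≈[ 1 ] nq (n ∸ j) * nq (n ∸ j)
  [½+j]²≈[n-j]² j j≤n = squares-≈ (subst (p^ 1 ∣_) (sym ½+j+[n-j]≡h) p∣h) (∣-½+ j) (∣-nq (n ∸ j))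
    where
    ½+j+[n-j]≡h : ½ + nq j + nq (n ∸ j) ≡ h
    ½+j+[n-j]≡h = trans (+-assoc ½ (nq j) (nq (n ∸ j)))
      (trans (cong (½ +_) (sym (nq-+ j (n ∸ j)))) (trans (cong (λ m → ½ + nq m) (ℕ.m+[n∸m]≡n j≤n)) ½+n≡h))

  poch½²*fact²≈fact² : ∀ k → k ≤ n → (poch ½ k * poch ½ k) * (fact (n ∸ k) * fact (n ∸ k)) ≈[ 1 ] fact n * fact n
  poch½²*fact²≈fact² zero    _   = ≈-reflexive (*-identityˡ (fact n * fact n))
  poch½²*fact²≈fact² (suc k) k<n = begin
    (poch ½ k * c * (poch ½ k * c)) * (fact m * fact m)
      ≡⟨ solve 3 (λ a c f → (a :* c :* (a :* c)) :* (f :* f) := (a :* a) :* ((c :* c) :* (f :* f))) refl (poch ½ k) c (fact m) ⟩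
    (poch ½ k * poch ½ k) * ((c * c) * (fact m * fact m))
      ≈⟨ ≈-* ≈-refl (≈-* ([½+j]²≈[n-j]² k (ℕ.<⇒≤ k<n)) ≈-refl (∣-* (∣-nq (n ∸ k)) (∣-nq (n ∸ k))) F²∣)
             (∣-* (∣-poch½ k) (∣-poch½ k)) (∣-* (∣-* (∣-½+ k) (∣-½+ k)) F²∣) ⟩
    (poch ½ k * poch ½ k) * ((nq (n ∸ k) * nq (n ∸ k)) * (fact m * fact m))
      ≡⟨ cong ((poch ½ k * poch ½ k) *_) [n-k]²*fact²≡fact² ⟩
    (poch ½ k * poch ½ k) * (fact (n ∸ k) * fact (n ∸ k))
      ≈⟨ poch½²*fact²≈fact² k (ℕ.<⇒≤ k<n) ⟩
    fact n * fact n ∎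
    where
    open ≈-Reasoning 1
    c : ℚ
    c = ½ + nq k
    m : ℕ
    m = n ∸ suc k
    F²∣ : p^ 0 ∣ (fact m * fact m)
    F²∣ = ∣-* (∣-fact m) (∣-fact m)
    [n-k]²*fact²≡fact² : (nq (n ∸ k) * nq (n ∸ k)) * (fact m * fact m) ≡ fact (n ∸ k) * fact (n ∸ k)
    [n-k]²*fact²≡fact² rewrite n∸j≡1+[n∸1+j] k k<n | sym (nq-suc m) =
      solve 2 (λ x f → (x :* x) :* (f :* f) := (f :* x) :* (f :* x)) refl (1ℚ + nq m) (fact m)

  bin : ℕ → ℚ
  bin k = nq (n C k)

  bin⁴ : ℕ → ℚ
  bin⁴ k = (bin k * bin k) * (bin k * bin k)

  ∣-bin² : ∀ k → p^ 0 ∣ (bin k * bin k)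
  ∣-bin² k = ∣-* (∣-nq (n C k)) (∣-nq (n C k))

  ∣-bin⁴ : ∀ k → p^ 0 ∣ bin⁴ k
  ∣-bin⁴ k = ∣-* (∣-bin² k) (∣-bin² k)

  ρ²≈bin² : ∀ k → k ≤ n → ρ k * ρ k ≈[ 1 ] bin k * bin k
  ρ²≈bin² k k≤n = ≈-÷ (poch½²*fact²≈fact² k k≤n) ≈-refl u u (∣-* (∣-fact n) (∣-fact n))
    (begin
      (ρ k * ρ k) * (F * F)
        ≡⟨ solve 3 (λ r a b → (r :* r) :* ((a :* b) :* (a :* b)) := ((r :* a) :* (r :* a)) :* (b :* b)) refl
             (ρ k) (fact k) (fact (n ∸ k)) ⟩
      ((ρ k * fact k) * (ρ k * fact k)) * (fact (n ∸ k) * fact (n ∸ k))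
        ≡⟨ cong (λ z → (z * z) * (fact (n ∸ k) * fact (n ∸ k))) (ρ*fact≡poch½ k k≤n) ⟩
      (poch ½ k * poch ½ k) * (fact (n ∸ k) * fact (n ∸ k)) ∎)
    (begin
      (bin k * bin k) * (F * F)  ≡⟨ solve 2 (λ b f → (b :* b) :* (f :* f) := (b :* f) :* (b :* f)) refl (bin k) F ⟩
      (bin k * F) * (bin k * F)  ≡⟨ cong₂ _*_ (nCk*fact*fact≡fact k≤n) (nCk*fact*fact≡fact k≤n) ⟩
      fact n * fact n            ∎)
    where
    open ≡-Reasoning
    F : ℚ
    F = fact k * fact (n ∸ k)
    u : Unit (F * F)
    u = Unit-* uF uF
      where
      uF : Unit F
      uF = Unit-* (Unit-fact k k≤n) (Unit-fact (n ∸ k) (ℕ.m∸n≤m n k))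

  rhsTerm≈bin⁴ : ∀ k → k ≤ n → rhsTerm k ≈[ 1 ] bin⁴ k
  rhsTerm≈bin⁴ k k≤n = begin
    ρ k * ρ k * ρ k * ρ k      ≡⟨ solve 1 (λ r → r :* r :* r :* r := (r :* r) :* (r :* r)) refl (ρ k) ⟩
    (ρ k * ρ k) * (ρ k * ρ k)  ≈⟨ ≈-* (ρ²≈bin² k k≤n) (ρ²≈bin² k k≤n) (∣-bin² k) (∣-* (∣-ρ k k≤n) (∣-ρ k k≤n)) ⟩
    bin⁴ k                     ∎
    where open ≈-Reasoning 1

  bin⁴-sym : ∀ k → k ≤ n → bin⁴ (n ∸ k) ≡ bin⁴ k
  bin⁴-sym k k≤n = cong (λ b → (nq b * nq b) * (nq b * nq b)) (sym (nCk≡nC[n∸k] k≤n))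

  Unit-[n-j]² : ∀ j → j < n → Unit (nq (n ∸ j) * nq (n ∸ j))
  Unit-[n-j]² j j<n = Unit-* u u
    where
    u : Unit (nq (n ∸ j))
    u = Unit-nq≤n (n ∸ j) (ℕ.m<n⇒0<n∸m j<n) (ℕ.m∸n≤m n j)

  H₂-split : ∀ k → k ≤ n → Σ[ j < k ] invSq (n ∸ j) + H₂ (n ∸ k) ≡ H₂ n
  H₂-split zero    _   = +-identityˡ (H₂ n)
  H₂-split (suc k) k<n = begin
    Σ[ j < suc k ] invSq (n ∸ j) + H₂ m
      ≡⟨ cong (_+ H₂ m) (Σ<-snoc k (λ j → invSq (n ∸ j))) ⟩
    (Σ[ j < k ] invSq (n ∸ j) + invSq (n ∸ k)) + H₂ m
      ≡⟨ solve 3 (λ a b c → (a :+ b) :+ c := a :+ (c :+ b)) refl (Σ[ j < k ] invSq (n ∸ j)) (invSq (n ∸ k)) (H₂ m) ⟩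
    Σ[ j < k ] invSq (n ∸ j) + (H₂ m + invSq (n ∸ k))
      ≡⟨ cong (λ i → Σ[ j < k ] invSq (n ∸ j) + (H₂ m + invSq i)) n∸k≡1+m ⟩
    Σ[ j < k ] invSq (n ∸ j) + (H₂ m + invSq (suc m))
      ≡⟨ cong (Σ[ j < k ] invSq (n ∸ j) +_) (sym (Σ<-snoc m (λ j → invSq (suc j)))) ⟩
    Σ[ j < k ] invSq (n ∸ j) + H₂ (suc m)
      ≡⟨ cong (λ i → Σ[ j < k ] invSq (n ∸ j) + H₂ i) (sym n∸k≡1+m) ⟩
    Σ[ j < k ] invSq (n ∸ j) + H₂ (n ∸ k)
      ≡⟨ H₂-split k (ℕ.<⇒≤ k<n) ⟩
    H₂ n ∎
    where
    open ≡-Reasoning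
    m : ℕ
    m = n ∸ suc k
    n∸k≡1+m : n ∸ k ≡ suc m
    n∸k≡1+m = n∸j≡1+[n∸1+j] k k<n

  H₂½≈ : ∀ k → k ≤ n → H₂½ k ≈[ 1 ] H₂ n - H₂ (n ∸ k)
  H₂½≈ k k≤n = begin
    H₂½ k
      ≈⟨ Σ<-≈ k _ _ (λ j j<k → ≈-⁻¹ (Unit-[½+j]² j (j<n j<k)) (Unit-[n-j]² j (j<n j<k)) ([½+j]²≈[n-j]² j (ℕ.<⇒≤ (j<n j<k)))) ⟩
    Σ[ j < k ] invSq (n ∸ j)
      ≡⟨ solve 2 (λ a b → a := (a :+ b) :- b) refl (Σ[ j < k ] invSq (n ∸ j)) (H₂ (n ∸ k)) ⟩
    (Σ[ j < k ] invSq (n ∸ j) + H₂ (n ∸ k)) - H₂ (n ∸ k)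
      ≡⟨ cong (_- H₂ (n ∸ k)) (H₂-split k k≤n) ⟩
    H₂ n - H₂ (n ∸ k) ∎
    where
    open ≈-Reasoning 1
    j<n : ∀ {j} → j < k → j < n
    j<n j<k = ℕ.<-≤-trans j<k k≤n

  Σbin⁴H₂-reflect : Σ[ k < suc n ] (bin⁴ k * H₂ (n ∸ k)) ≡ Σ[ k < suc n ] (bin⁴ k * H₂ k)
  Σbin⁴H₂-reflect = trans (Σ<-cong (suc n) (λ k k<1+n → cong (_* H₂ (n ∸ k)) (sym (bin⁴-sym k (ℕ.<⇒≤pred k<1+n)))))
    (Σ<-reverse (suc n) (λ k → bin⁴ k * H₂ k))

  W≈ : Σ[ k < suc n ] (rhsTerm k * (H₂½ k + H₂ k)) ≈[ 1 ] H₂ n * Σ< (suc n) bin⁴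
  W≈ = begin
    Σ[ k < suc n ] (rhsTerm k * (H₂½ k + H₂ k))
      ≈⟨ Σ<-≈ (suc n) _ _ (λ k k<1+n → let k≤n = ℕ.<⇒≤pred k<1+n in
           ≈-* (rhsTerm≈bin⁴ k k≤n) (≈-+ (H₂½≈ k k≤n) ≈-refl) (∣-bin⁴ k) (∣-+ (∣-H₂½ k k≤n) (∣-H₂ k k≤n))) ⟩
    Σ[ k < suc n ] (bin⁴ k * ((H₂ n - H₂ (n ∸ k)) + H₂ k))
      ≡⟨ Σ<-cong (suc n) (λ k _ → solve 4 (λ e c a b → e :* ((c :- a) :+ b) := c :* e :+ (e :* b :+ :- (e :* a))) refl
                                     (bin⁴ k) (H₂ n) (H₂ (n ∸ k)) (H₂ k)) ⟩
    Σ[ k < suc n ] (H₂ n * bin⁴ k + (bin⁴ k * H₂ k + - (bin⁴ k * H₂ (n ∸ k))))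
      ≡⟨ Σ<-+ (suc n) (λ k → H₂ n * bin⁴ k) (λ k → bin⁴ k * H₂ k + - (bin⁴ k * H₂ (n ∸ k))) ⟩
    Σ[ k < suc n ] (H₂ n * bin⁴ k) + Σ[ k < suc n ] (bin⁴ k * H₂ k + - (bin⁴ k * H₂ (n ∸ k)))
      ≡⟨ cong₂ _+_ (Σ<-*ˡ (suc n) (H₂ n) bin⁴) (trans (Σ<-+ (suc n) (λ k → bin⁴ k * H₂ k) (λ k → - (bin⁴ k * H₂ (n ∸ k))))
                                                    (cong (Σ[ k < suc n ] (bin⁴ k * H₂ k) +_) (Σ<-neg (suc n) (λ k → bin⁴ k * H₂ (n ∸ k))))) ⟩
    H₂ n * Σ< (suc n) bin⁴ + (Σ[ k < suc n ] (bin⁴ k * H₂ k) + - Σ[ k < suc n ] (bin⁴ k * H₂ (n ∸ k)))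
      ≡⟨ cong (λ s → H₂ n * Σ< (suc n) bin⁴ + (Σ[ k < suc n ] (bin⁴ k * H₂ k) + - s)) Σbin⁴H₂-reflect ⟩
    H₂ n * Σ< (suc n) bin⁴ + (Σ[ k < suc n ] (bin⁴ k * H₂ k) + - Σ[ k < suc n ] (bin⁴ k * H₂ k))
      ≡⟨ solve 2 (λ a b → a :+ (b :+ :- b) := a) refl (H₂ n * Σ< (suc n) bin⁴) (Σ[ k < suc n ] (bin⁴ k * H₂ k)) ⟩
    H₂ n * Σ< (suc n) bin⁴ ∎
    where open ≈-Reasoning 1

  invSq-complement : ∀ a b → a ℕ.+ b ≡ p → 0 < a → 0 < b → invSq a ≈[ 1 ] invSq b
  invSq-complement a b a+b≡p 0<a 0<b = ≈-⁻¹ (Unit-* ua ua) (Unit-* ub ub)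
    (squares-≈ (subst (p^ 1 ∣_) (trans (cong nq (sym a+b≡p)) (nq-+ a b)) p^1∣p) (∣-nq a) (∣-nq b))
    where
    ua : Unit (nq a)
    ua = Unit-nq a 0<a (subst (a <_) a+b≡p (ℕ.m<m+n a 0<b))
    ub : Unit (nq b)
    ub = Unit-nq b 0<b (subst (b <_) (trans (ℕ.+-comm b a) a+b≡p) (ℕ.m<m+n b 0<a))

  invSq-double : ∀ m → Unit (nq m) → invSq (m ℕ.+ m) ≡ invSq 2 * invSq m
  invSq-double m um = sym (q*y≡x⇒q≡x÷?y 1ℚ (nq (m ℕ.+ m) * nq (m ℕ.+ m)) (invSq 2 * invSq m) (Unit⇒≢0 (Unit-* u2m u2m)) (begin
    (invSq 2 * invSq m) * (nq (m ℕ.+ m) * nq (m ℕ.+ m))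
      ≡⟨ cong (λ x → (invSq 2 * invSq m) * (x * x)) (nq-+ m m) ⟩
    (invSq 2 * invSq m) * ((nq m + nq m) * (nq m + nq m))
      ≡⟨ solve 3 (λ i j x → (i :* j) :* ((x :+ x) :* (x :+ x)) := (i :* ((con 1ℚ :+ con 1ℚ) :* (con 1ℚ :+ con 1ℚ))) :* (j :* (x :* x)))
           refl (invSq 2) (invSq m) (nq m) ⟩
    (invSq 2 * (nq 2 * nq 2)) * (invSq m * (nq m * nq m))
      ≡⟨ cong₂ _*_ (x⁻¹*x≡1 _ (Unit⇒≢0 (Unit-* Unit-2 Unit-2))) (x⁻¹*x≡1 _ (Unit⇒≢0 (Unit-* um um))) ⟩
    1ℚ * 1ℚ ≡⟨⟩
    1ℚ ∎))
    where
    open ≡-Reasoning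
    u2m : Unit (nq (m ℕ.+ m))
    u2m = subst Unit (sym (trans (nq-+ m m) (solve 1 (λ x → x :+ x := (con 1ℚ :+ con 1ℚ) :* x) refl (nq m)))) (Unit-* Unit-2 um)

  H₂-reflect : Σ[ j < n ] invSq (n ∸ j) ≡ H₂ n
  H₂-reflect = trans (Σ<-cong n (λ j j<n → cong invSq (n∸j≡1+[n∸1+j] j j<n))) (Σ<-reverse n (λ j → invSq (suc j)))

  H₂[p-1] : ℚ
  H₂[p-1] = H₂ (n ℕ.+ n)

  H₂[p-1]≈2H₂ : H₂[p-1] ≈[ 1 ] H₂ n + H₂ n
  H₂[p-1]≈2H₂ = begin
    H₂ (n ℕ.+ n)
      ≡⟨ Σ<-split n n (λ j → invSq (suc j)) ⟩
    H₂ n + Σ[ j < n ] invSq (suc (n ℕ.+ j))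
      ≈⟨ ≈-+ (≈-refl {x = H₂ n}) (Σ<-≈ n _ _ (λ j j<n → invSq-complement (suc (n ℕ.+ j)) (n ∸ j)
           (cong suc (trans (ℕ.+-assoc n j (n ∸ j)) (cong (n ℕ.+_) (ℕ.m+[n∸m]≡n (ℕ.<⇒≤ j<n)))))
           (s≤s z≤n) (ℕ.m<n⇒0<n∸m j<n))) ⟩
    H₂ n + Σ[ j < n ] invSq (n ∸ j)
      ≡⟨ cong (H₂ n +_) H₂-reflect ⟩
    H₂ n + H₂ n ∎
    where open ≈-Reasoning 1

  H₂[p-1]≈½H₂ : H₂[p-1] ≈[ 1 ] invSq 2 * H₂ n + invSq 2 * H₂ n
  H₂[p-1]≈½H₂ = begin
    H₂ (n ℕ.+ n)
      ≡⟨ Σ<-evenOdd n (λ j → invSq (suc j)) ⟩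
    Σ[ j < n ] invSq (suc (j ℕ.+ j)) + Σ[ j < n ] invSq (suc (suc (j ℕ.+ j)))
      ≈⟨ ≈-+ (Σ<-≈ n _ _ odd) (≈-reflexive (Σ<-cong n even)) ⟩
    Σ[ j < n ] (invSq 2 * invSq (n ∸ j)) + Σ[ j < n ] (invSq 2 * invSq (suc j))
      ≡⟨ cong₂ _+_ (trans (Σ<-*ˡ n (invSq 2) _) (cong (invSq 2 *_) H₂-reflect)) (Σ<-*ˡ n (invSq 2) _) ⟩
    invSq 2 * H₂ n + invSq 2 * H₂ n ∎
    where
    open ≈-Reasoning 1
    odd : ∀ j → j < n → invSq (suc (j ℕ.+ j)) ≈[ 1 ] invSq 2 * invSq (n ∸ j)
    odd j j<n = ≈-trans
      (invSq-complement (suc (j ℕ.+ j)) ((n ∸ j) ℕ.+ (n ∸ j))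
        (trans (2j+1+2d≡2[j+d]+1 j (n ∸ j)) (cong (λ m → suc (m ℕ.+ m)) (ℕ.m+[n∸m]≡n (ℕ.<⇒≤ j<n))))
        (s≤s z≤n) (ℕ.+-mono-≤ (ℕ.m<n⇒0<n∸m j<n) z≤n))
      (≈-reflexive (invSq-double (n ∸ j) (Unit-nq≤n (n ∸ j) (ℕ.m<n⇒0<n∸m j<n) (ℕ.m∸n≤m n j))))
      where
      2j+1+2d≡2[j+d]+1 : ∀ j d → suc (j ℕ.+ j) ℕ.+ (d ℕ.+ d) ≡ suc ((j ℕ.+ d) ℕ.+ (j ℕ.+ d))
      2j+1+2d≡2[j+d]+1 = solve-∀
    even : ∀ j → j < n → invSq (suc (suc (j ℕ.+ j))) ≡ invSq 2 * invSq (suc j)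
    even j j<n = trans (cong invSq (cong suc (sym (ℕ.+-suc j j)))) (invSq-double (suc j) (Unit-nq≤n (suc j) (s≤s z≤n) j<n))

  -- The two evaluations differ by (3/2) H₂(n), and 3 is a unit because p > 3.
  p∣H₂ : p^ 1 ∣ H₂ n
  p∣H₂ = ∣-÷ (∣-*ʳ (difference (≈-trans (≈-sym H₂[p-1]≈2H₂) H₂[p-1]≈½H₂)) (∣-nq 2)) Unit-3
    (solve 3 (λ t c w → t :* (((con 1ℚ :+ con 1ℚ) :- (c :+ c)) :* w) := ((t :+ t) :- (c :* t :+ c :* t)) :* w) refl (H₂ n) (invSq 2) (nq 2))

  W : ℚ
  W = Σ[ k < suc n ] (rhsTerm k * (H₂½ k + H₂ k))

  sum-lhsTerm≈ : sumTo n (lhsTerm p) ≈[ 4 ] sumTo n rhsTerm - ε * W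
  sum-lhsTerm≈ = begin
    sumTo n (lhsTerm p)
      ≡⟨ sumTo≡Σ< n (lhsTerm p) ⟩
    Σ< (suc n) (lhsTerm p)
      ≈⟨ Σ<-≈ (suc n) _ _ (λ k k<1+n → lhsTerm≈ k (ℕ.<⇒≤pred k<1+n)) ⟩
    Σ[ k < suc n ] (rhsTerm k * (1ℚ - ε * (H₂½ k + H₂ k)))
      ≡⟨ Σ<-cong (suc n) (λ k _ → solve 3 (λ r e s → r :* (con 1ℚ :- e :* s) := r :+ :- (e :* (r :* s))) refl (rhsTerm k) ε (H₂½ k + H₂ k)) ⟩
    Σ[ k < suc n ] (rhsTerm k + - (ε * (rhsTerm k * (H₂½ k + H₂ k))))
      ≡⟨ Σ<-+ (suc n) rhsTerm (λ k → - (ε * (rhsTerm k * (H₂½ k + H₂ k)))) ⟩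
    Σ< (suc n) rhsTerm + Σ[ k < suc n ] (- (ε * (rhsTerm k * (H₂½ k + H₂ k))))
      ≡⟨ cong₂ _+_ (sym (sumTo≡Σ< n rhsTerm))
           (trans (Σ<-neg (suc n) (λ k → ε * (rhsTerm k * (H₂½ k + H₂ k)))) (cong -_ (Σ<-*ˡ (suc n) ε (λ k → rhsTerm k * (H₂½ k + H₂ k))))) ⟩
    sumTo n rhsTerm - ε * W ∎
    where open ≈-Reasoning 4

  supercongruence : sumTo n (lhsTerm p) ≡ sumTo n rhsTerm [modℚ p ^ 3 ]
  supercongruence = ∣⇒≡[modℚ] (sumTo n (lhsTerm p)) (sumTo n rhsTerm) (difference (begin
    sumTo n (lhsTerm p)      ≈⟨ ≈-weaken 3 sum-lhsTerm≈ ⟩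
    sumTo n rhsTerm - ε * W  ≈⟨ congruent (subst (p^ 3 ∣_) (solve 2 (λ r w → :- w := (r :- w) :- r) refl (sumTo n rhsTerm) (ε * W))
                                  (∣-neg (∣-* p²∣ε p∣W))) ⟩
    sumTo n rhsTerm          ∎))
    where
    open ≈-Reasoning 3
    p∣W : p^ 1 ∣ W
    p∣W = ∣-≈ W≈ (∣-*ʳ p∣H₂ (Σ<-∣ (suc n) bin⁴ (λ k _ → ∣-bin⁴ k)))

[p-1]/2+[p-1]/2≡p-1 : ∀ q → Prime (suc q) → 2 < q → q / 2 ℕ.+ q / 2 ≡ q
[p-1]/2+[p-1]/2≡p-1 q p-prime 2<q with q % 2 | m%n<n q 2 | m≡m%n+[m/n]*n q 2
... | 0 | _ | q≡[q/2]*2 = sym (trans q≡[q/2]*2 (trans (ℕ.*-comm (q / 2) 2) (cong (q / 2 ℕ.+_) (ℕ.+-identityʳ (q / 2)))))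
... | 1 | _ | q≡1+[q/2]*2 = ⊥-elim (Prime.notComposite p-prime
  (hasNonTrivialDivisor {divisor = 2} (s≤s (ℕ.<⇒≤ 2<q)) (ℕ∣.divides (suc (q / 2)) (cong suc q≡1+[q/2]*2))))
... | suc (suc _) | s≤s (s≤s ()) | _

supercongruence-at : ∀ q n → n ℕ.+ n ≡ q → Prime (suc q) → 1 < n →
  sumTo n (lhsTerm (suc q)) ≡ sumTo n rhsTerm [modℚ suc q ^ 3 ]
supercongruence-at .(n ℕ.+ n) n refl p-prime 1<n = Supercongruence.supercongruence n p-prime 1<n

mainTheorem9 : (p : ℕ) → Prime p → 3 < p →
    sumTo ((p ∸ 1) / 2) (lhsTerm p) ≡ sumTo ((p ∸ 1) / 2) rhsTerm [modℚ p ^ 3 ]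
mainTheorem9 (suc q) p-prime (s≤s 2<q) = supercongruence-at q (q / 2) 2n≡q p-prime 1<n
  where
  2n≡q : q / 2 ℕ.+ q / 2 ≡ q
  2n≡q = [p-1]/2+[p-1]/2≡p-1 q p-prime 2<q
  1<n : 1 < q / 2
  1<n = ℕ.≰⇒> (λ n≤1 → ℕ.<⇒≱ 2<q (subst (ℕ._≤ 2) 2n≡q (ℕ.+-mono-≤ n≤1 n≤1)))
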